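{- Let $S$ be a subtraction algebra and $a\in S$. There is a bijection between ultrafilters of the Boolean algebra $a^{\downarrow}$ and maximal filters of $S$ containing $a$. More precisely, if $\mu\subseteq S$ is a maximal filter containing $a$ then $\mu\cap a^{\downarrow}$ is an ultrafilter of $a^{\downarrow}$; if $\nu\subseteq a^{\downarrow}$ is an ultrafilter then its upward closure $\nu^{\uparrow}$ in $S$ is a maximal filter of $S$; and these two constructions are mutually inverse.
   Context: A subtraction algebra is a set with a binary operation $-$ satisfying $a-(b-a)=a$, $a-(a-b)=b-(b-a)$, and $(a-b)-c=(a-c)-b$. Writing $a\cdot b:=a-(a-b)$, it is a meet-semilattice ordered by $a\le b\iff a\cdot b=a$ with least element $0=a-a$; for each $a$, the downset $a^{\downarrow}=\{b\mid b\le a\}$ with meet $\cdot$, bottom $0$, top $a$ and complement $b\mapsto a-b$ is a Boolean algebra. A filter of $S$ is a nonempty upward closed subset closed under $\cdot$; a maximal filter is a proper filter ($\neq S$) maximal under inclusion among proper filters. -}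

module Defs where

open import Data.Product using (Σ; ∃; _×_; _,_)
open import Relation.Nullary using (¬_)
open import Relation.Binary.PropositionalEquality using (_≡_)

record SubtractionAlgebra : Set₁ where
  infixl 6 _−_
  field
    Carrier : Set
    _−_     : Carrier → Carrier → Carrier
    ax1 : ∀ a b → a − (b − a) ≡ a
    ax2 : ∀ a b → a − (a − b) ≡ b − (b − a)
    ax3 : ∀ a b c → (a − b) − c ≡ (a − c) − b

  infixl 7 _·_
  _·_ : Carrier → Carrier → Carrier
  a · b = a − (a − b)

  infix 4 _≤_
  _≤_ : Carrier → Carrier → Set
  a ≤ b = a · b ≡ a

Subset : Set → Set₁
Subset A = A → Set

module _ (S : SubtractionAlgebra) where
  open SubtractionAlgebra S

  _⊆_ : Subset Carrier → Subset Carrier → Set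
  P ⊆ Q = ∀ x → P x → Q x

  _≐_ : Subset Carrier → Subset Carrier → Set
  P ≐ Q = (P ⊆ Q) × (Q ⊆ P)

  IsFilter : Subset Carrier → Set
  IsFilter F =
    (∃ λ x → F x)
    × (∀ x y → F x → x ≤ y → F y)
    × (∀ x y → F x → F y → F (x · y))

  IsProper : Subset Carrier → Set
  IsProper F = ¬ (∀ x → F x)

  IsMaximalFilter : Subset Carrier → Set₁
  IsMaximalFilter F =
    IsFilter F × IsProper F
    × (∀ (G : Subset Carrier) → IsFilter G → IsProper G → F ⊆ G → G ⊆ F)

  ↓_ : Carrier → Subset Carrier
  (↓ a) x = x ≤ a

  IsFilter↓ : Carrier → Subset Carrier → Set
  IsFilter↓ a F =
    (F ⊆ (↓ a))
    × (∃ λ x → F x)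
    × (∀ x y → F x → x ≤ y → y ≤ a → F y)
    × (∀ x y → F x → F y → F (x · y))

  IsProper↓ : Carrier → Subset Carrier → Set
  IsProper↓ a F = ¬ (∀ x → x ≤ a → F x)

  IsUltrafilter↓ : Carrier → Subset Carrier → Set₁
  IsUltrafilter↓ a F =
    IsFilter↓ a F × IsProper↓ a F
    × (∀ (G : Subset Carrier) → IsFilter↓ a G → IsProper↓ a G → F ⊆ G → G ⊆ F)

  restrict : Carrier → Subset Carrier → Subset Carrier
  restrict a μ x = μ x × x ≤ a

  upClosure : Subset Carrier → Subset Carrier
  upClosure ν x = ∃ λ y → ν y × y ≤ x

-- Both
-- constructions are monotone, and for filters μ ∋ a and filters ν of a↓ one has
-- (μ ∩ a↓)↑ = μ (every x ∈ μ lies above x · a ∈ μ ∩ a↓) and ν↑ ∩ a↓ = ν. With these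
-- two identities, maximality transfers across the correspondence, while properness
-- transfers because a filter is improper exactly when it contains the least element.
module Submission where

open import Defs
open import Data.Product using (∃; _×_; _,_; proj₁; proj₂)
open import Relation.Binary.PropositionalEquality
  using (_≡_; sym; trans; cong; subst; module ≡-Reasoning)

module SubtractionAlgebraProperties (S : SubtractionAlgebra) where
  open SubtractionAlgebra S
  open ≡-Reasoning

  ≤-refl : ∀ x → x ≤ x
  ≤-refl x = ax1 x x

  x−y−[z−x]≡x−y : ∀ x y z → x − y − (z − x) ≡ x − y
  x−y−[z−x]≡x−y x y z = trans (sym (ax3 x (z − x) y)) (cong (_− y) (ax1 x z))

  x−y≤x : ∀ x y → x − y ≤ x
  x−y≤x x y = x−y−[z−x]≡x−y x y (x − y)

  x−x−y≡x−x : ∀ x y → x − x − y ≡ x − x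
  x−x−y≡x−x x y = begin
    x − x − y                       ≡⟨ sym (x−y≤x (x − x) y) ⟩
    (x − x − y) · (x − x)           ≡⟨ sym (ax2 (x − x) (x − x − y)) ⟩
    (x − x) · (x − x − y)           ≡⟨ cong (x − x −_) (ax3 x x (x − x − y)) ⟩
    x − x − (x − (x − x − y) − x)   ≡⟨ x−y−[z−x]≡x−y x x (x − (x − x − y)) ⟩
    x − x                           ∎

  x−x≤y : ∀ x y → x − x ≤ y
  x−x≤y x y = trans (cong ((x − x) −_) (x−x−y≡x−x x y)) (x−x−y≡x−x x (x − x))

  ≤-antisym : ∀ {x y} → x ≤ y → y ≤ x → x ≡ y
  ≤-antisym {x} {y} x≤y y≤x = trans (sym x≤y) (trans (ax2 x y) y≤x)

  x−x≡y−y : ∀ x y → x − x ≡ y − y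
  x−x≡y−y x y = ≤-antisym (x−x≤y x (y − y)) (x−x≤y y (x − x))

  x−[y−y]≡x : ∀ x y → x − (y − y) ≡ x
  x−[y−y]≡x x y = trans (cong (x −_) (x−x≡y−y y x)) (ax1 x x)

  ≤⇒x−y≡y−y : ∀ {x y} → x ≤ y → x − y ≡ y − y
  ≤⇒x−y≡y−y {x} {y} x≤y = begin
    x − y                ≡⟨ cong (_− y) (sym x≤y) ⟩
    x − (x − y) − y      ≡⟨ ax3 x (x − y) y ⟩
    x − y − (x − y)      ≡⟨ x−x≡y−y (x − y) y ⟩
    y − y                ∎

  x−y≡z−z⇒x≤y : ∀ {x y} z → x − y ≡ z − z → x ≤ y
  x−y≡z−z⇒x≤y {x} z x−y≡0 = trans (cong (x −_) x−y≡0) (x−[y−y]≡x x z)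

  ≤-trans : ∀ {x y z} → x ≤ y → y ≤ z → x ≤ z
  ≤-trans {x} {y} {z} x≤y y≤z = x−y≡z−z⇒x≤y z (begin
    x − z                ≡⟨ cong (_− z) (trans (sym x≤y) (ax2 x y)) ⟩
    y − (y − x) − z      ≡⟨ ax3 y (y − x) z ⟩
    y − z − (y − x)      ≡⟨ cong (_− (y − x)) (≤⇒x−y≡y−y y≤z) ⟩
    z − z − (y − x)      ≡⟨ x−x−y≡x−x z (y − x) ⟩
    z − z                ∎)

  x·y≤y : ∀ x y → x · y ≤ y
  x·y≤y x y = x−y≡z−z⇒x≤y (x − y) (ax3 x (x − y) y)

  x·y≤x : ∀ x y → x · y ≤ x
  x·y≤x x y = subst (_≤ x) (sym (ax2 x y)) (x·y≤y y x)

  ·-greatest : ∀ {z x y} → z ≤ x → z ≤ y → z ≤ x · y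
  ·-greatest {z} {x} {y} z≤x z≤y = x−y≡z−z⇒x≤y y (begin
    z − x · y                ≡⟨ cong (_− x · y) (trans (sym z≤x) (ax2 z x)) ⟩
    x − (x − z) − x · y      ≡⟨ ax3 x (x − z) (x · y) ⟩
    x − x · y − (x − z)      ≡⟨ cong (_− (x − z)) (trans (ax2 x (x − y)) (x−y≤x x y)) ⟩
    x − y − (x − z)          ≡⟨ sym (ax3 x (x − z) y) ⟩
    x − (x − z) − y          ≡⟨ cong (_− y) (trans (sym (ax2 z x)) z≤x) ⟩
    z − y                    ≡⟨ ≤⇒x−y≡y−y z≤y ⟩
    y − y                    ∎)

  ·-mono-≤ : ∀ {x x′ y y′} → x ≤ x′ → y ≤ y′ → x · y ≤ x′ · y′
  ·-mono-≤ {x = x} {y = y} x≤x′ y≤y′ =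
    ·-greatest (≤-trans (x·y≤x x y) x≤x′) (≤-trans (x·y≤y x y) y≤y′)

module FilterCorrespondence (S : SubtractionAlgebra) where
  open SubtractionAlgebra S
  open SubtractionAlgebraProperties S

  upClosure-mono : ∀ {P Q} → _⊆_ S P Q → _⊆_ S (upClosure S P) (upClosure S Q)
  upClosure-mono P⊆Q x (y , Py , y≤x) = y , P⊆Q y Py , y≤x

  upClosure-isFilter : ∀ {ν} → ∃ ν → (∀ x y → ν x → ν y → ν (x · y))
                     → IsFilter S (upClosure S ν)
  upClosure-isFilter (y , νy) ν-meet =
    (y , y , νy , ≤-refl y) ,
    (λ _ _ (w , νw , w≤x) x≤z → w , νw , ≤-trans w≤x x≤z) ,
    (λ _ _ (v , νv , v≤x) (w , νw , w≤z) → v · w , ν-meet v w νv νw , ·-mono-≤ v≤x w≤z)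

  module _ (a : Carrier) where

    restrict-mono : ∀ {P Q} → _⊆_ S P Q → _⊆_ S (restrict S a P) (restrict S a Q)
    restrict-mono P⊆Q x (Px , x≤a) = P⊆Q x Px , x≤a

    restrict-isFilter↓ : ∀ {μ} → IsFilter S μ → μ a → IsFilter↓ S a (restrict S a μ)
    restrict-isFilter↓ (_ , μ-up , μ-meet) μa =
      (λ _ → proj₂) ,
      (a , μa , ≤-refl a) ,
      (λ x y (μx , _) x≤y y≤a → μ-up x y μx x≤y , y≤a) ,
      (λ x y (μx , x≤a) (μy , _) → μ-meet x y μx μy , ≤-trans (x·y≤x x y) x≤a)

    restrict-isProper↓ : ∀ {μ} → IsFilter S μ → IsProper S μ → IsProper↓ S a (restrict S a μ)
    restrict-isProper↓ (_ , μ-up , _) μ-proper ↓a⊆μ =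
      μ-proper (λ x → μ-up (a − a) x (proj₁ (↓a⊆μ (a − a) (x−x≤y a a))) (x−x≤y a x))

    upClosure-isProper : ∀ {ν} → IsFilter↓ S a ν → IsProper↓ S a ν → IsProper S (upClosure S ν)
    upClosure-isProper (_ , _ , ν-up , _) ν-proper ν↑-total =
      let (y , νy , y≤0) = ν↑-total (a − a)
      in ν-proper (λ x x≤a → ν-up y x νy (≤-trans y≤0 (x−x≤y a x)) x≤a)

    upClosure∋a : ∀ {ν} → IsFilter↓ S a ν → upClosure S ν a
    upClosure∋a (ν⊆↓a , (y , νy) , _) = y , νy , ν⊆↓a y νy

    upClosure-restrict≐ : ∀ {μ} → IsFilter S μ → μ a → _≐_ S (upClosure S (restrict S a μ)) μ
    upClosure-restrict≐ (_ , μ-up , μ-meet) μa =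
      (λ x (y , (μy , _) , y≤x) → μ-up y x μy y≤x) ,
      (λ x μx → x · a , (μ-meet x a μx μa , x·y≤y x a) , x·y≤x x a)

    restrict-upClosure≐ : ∀ {ν} → IsFilter↓ S a ν → _≐_ S (restrict S a (upClosure S ν)) ν
    restrict-upClosure≐ (ν⊆↓a , _ , ν-up , _) =
      (λ x ((y , νy , y≤x) , x≤a) → ν-up y x νy y≤x x≤a) ,
      (λ x νx → (x , νx , ≤-refl x) , ν⊆↓a x νx)

    restrict-isUltrafilter↓ : ∀ {μ} → IsMaximalFilter S μ → μ a
                            → IsUltrafilter↓ S a (restrict S a μ)
    restrict-isUltrafilter↓ {μ} (μ-filter , μ-proper , μ-maximal) μa =
      restrict-isFilter↓ μ-filter μa ,
      restrict-isProper↓ μ-filter μ-proper ,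
      λ G G-filter@(_ , G-nonempty , _ , G-meet) G-proper μ↓⊆G x Gx →
        let μ⊆G↑ : _⊆_ S μ (upClosure S G)
            μ⊆G↑ y μy = upClosure-mono μ↓⊆G y (proj₂ (upClosure-restrict≐ μ-filter μa) y μy)
            G↑⊆μ = μ-maximal (upClosure S G) (upClosure-isFilter G-nonempty G-meet)
                     (upClosure-isProper G-filter G-proper) μ⊆G↑
        in restrict-mono G↑⊆μ x (proj₂ (restrict-upClosure≐ G-filter) x Gx)

    upClosure-isMaximalFilter : ∀ {ν} → IsUltrafilter↓ S a ν → IsMaximalFilter S (upClosure S ν)
    upClosure-isMaximalFilter {ν} (ν-filter@(_ , ν-nonempty , _ , ν-meet) , ν-proper , ν-maximal) =
      upClosure-isFilter ν-nonempty ν-meet ,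
      upClosure-isProper ν-filter ν-proper ,
      λ G G-filter G-proper ν↑⊆G x Gx →
        let Ga = ν↑⊆G a (upClosure∋a ν-filter)
            ν⊆G↓ : _⊆_ S ν (restrict S a G)
            ν⊆G↓ y νy = restrict-mono ν↑⊆G y (proj₂ (restrict-upClosure≐ ν-filter) y νy)
            G↓⊆ν = ν-maximal (restrict S a G) (restrict-isFilter↓ G-filter Ga)
                     (restrict-isProper↓ G-filter G-proper) ν⊆G↓
        in upClosure-mono G↓⊆ν x (proj₂ (upClosure-restrict≐ G-filter Ga) x Gx)

proposition5p1 : (S : SubtractionAlgebra) (a : SubtractionAlgebra.Carrier S)
    → ((μ : Subset (SubtractionAlgebra.Carrier S))
        → IsMaximalFilter S μ → μ a → IsUltrafilter↓ S a (restrict S a μ))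
    × ((ν : Subset (SubtractionAlgebra.Carrier S))
        → IsUltrafilter↓ S a ν → IsMaximalFilter S (upClosure S ν) × upClosure S ν a)
    × ((μ : Subset (SubtractionAlgebra.Carrier S))
        → IsMaximalFilter S μ → μ a → _≐_ S (upClosure S (restrict S a μ)) μ)
    × ((ν : Subset (SubtractionAlgebra.Carrier S))
        → IsUltrafilter↓ S a ν → _≐_ S (restrict S a (upClosure S ν)) ν)
proposition5p1 S a =
  (λ μ → restrict-isUltrafilter↓ a) ,
  (λ ν ν-ultra → upClosure-isMaximalFilter a ν-ultra , upClosure∋a a (proj₁ ν-ultra)) ,
  (λ μ μ-maximal → upClosure-restrict≐ a (proj₁ μ-maximal)) ,
  (λ ν ν-ultra → restrict-upClosure≐ a (proj₁ ν-ultra))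
  where open FilterCorrespondence S
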